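{- If $G$ is a wheel or a fan graph of order $p$, then $str(G)=p+\delta(G)$.
   Context: A wheel is the graph obtained from a cycle $C_n$ ($n\ge3$) by adding one vertex adjacent to all vertices of the cycle; a fan is obtained from a path $P_n$ ($n\ge2$) by adding one vertex adjacent to all vertices of the path. $\delta$ denotes minimum degree. For a graph $G$ of order $p$, a numbering is a bijection $f:V(G)\to\{1,\dots,p\}$; $str_f(G)=\max\{f(u)+f(v): uv\in E(G)\}$ and $str(G)=\min\{str_f(G)\}$ over numberings. -}

module Defs where

open import Data.Nat using (ℕ; zero; suc; _+_; _∸_; _⊔_; _⊓_; _≤_; _≡ᵇ_)
open import Data.Bool using (Bool; true; false; _∧_; _∨_; not)
open import Data.Fin using (Fin; toℕ; zero; suc)
open import Data.List using (List; []; _∷_; length; filter; concatMap; map; foldr; allFin)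
open import Data.Product using (Σ; ∃; _×_; _,_)
open import Function.Definitions using (Bijective)
open import Relation.Binary.PropositionalEquality using (_≡_)
open import Relation.Nullary.Decidable using (Dec; yes; no)
open import Data.Bool using (T)
open import Data.Bool.Properties using (T?)

-- A finite simple graph on the vertex set Fin order, given by a
-- Boolean adjacency function (symmetric and irreflexive for the graphs below).
record Graph : Set where
  field
    order : ℕ
    adj   : Fin order → Fin order → Bool
open Graph public

deg : (G : Graph) → Fin (order G) → ℕ
deg G v = length (filter (λ u → T? (adj G v u)) (allFin (order G)))

-- minimum degree δ(G) (0 for the empty graph)
δ : Graph → ℕ
δ G with order G | deg G
... | zero  | _ = 0
... | suc m | d = foldr (λ v acc → d v ⊓ acc) (d zero) (allFin (suc m))

-- A numbering is a bijection f : V(G) → {1,…,p}; we encode it as a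
-- bijection f : Fin p → Fin p, the label of v being toℕ (f v) + 1.
Numbering : Graph → Set
Numbering G = Σ (Fin (order G) → Fin (order G)) (Bijective _≡_ _≡_)

label : {G : Graph} → Numbering G → Fin (order G) → ℕ
label (f , _) v = suc (toℕ (f v))

strF : (G : Graph) → Numbering G → ℕ
strF G f = foldr _⊔_ 0
  (concatMap (λ u → map (λ v → label {G} f u + label {G} f v)
                         (filter (λ v → T? (adj G u v)) (allFin (order G))))
             (allFin (order G)))

IsStr : Graph → ℕ → Set
IsStr G k = (Σ (Numbering G) λ f → strF G f ≡ k) × ((f : Numbering G) → k ≤ strF G f)

cycAdj : ℕ → ℕ → ℕ → Bool
cycAdj n a b = (b ≡ᵇ suc a) ∨ (a ≡ᵇ suc b)
             ∨ ((a ≡ᵇ 0) ∧ (b ≡ᵇ (n ∸ 1))) ∨ ((b ≡ᵇ 0) ∧ (a ≡ᵇ (n ∸ 1)))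

pathAdj : ℕ → ℕ → Bool
pathAdj a b = (b ≡ᵇ suc a) ∨ (a ≡ᵇ suc b)

-- cone over a graph on Fin n with adjacency r : vertex 0 is the hub,
-- vertex suc i corresponds to vertex i of the base graph.
cone : (n : ℕ) → (ℕ → ℕ → Bool) → Graph
cone n r = record { order = suc n ; adj = a }
  where
  a : Fin (suc n) → Fin (suc n) → Bool
  a zero zero = false
  a zero (suc _) = true
  a (suc _) zero = true
  a (suc i) (suc j) = r (toℕ i) (toℕ j)

-- wheel W_n = C_n + hub (n ≥ 3), order n+1
wheel : ℕ → Graph
wheel n = cone n (cycAdj n)

-- fan F_n = P_n + hub (n ≥ 2), order n+1
fan : ℕ → Graph
fan n = cone n pathAdj

-- Lower bound, valid for every graph with δ ≥ 1: the vertex labelled p has at least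
-- δ neighbours, whose labels are distinct, so one of them is labelled at least δ and
-- that edge has weight at least p + δ.
-- Upper bound: label the hub 1 and number the rim in zigzag order 0, n−1, 1, n−2, …
-- (shifted by 2), where consecutive positions carry values summing to n−1 or n.  Every
-- wheel edge then has weight at most p + 3; reversing the zigzag brings the sums of
-- consecutive values down to n−2 or n−1, so every fan edge has weight at most p + 2.
-- Since δ is 3 for wheels and 2 for fans, the two bounds meet.
module Submission where

open import Defs
open import Algebra.Properties.CommutativeSemigroup using (interchange)
open import Data.Bool using (Bool; T; _∨_; _∧_)
open import Data.Bool.Properties using (T?; T-∨; T-∧)
open import Data.Fin using (Fin; zero; suc; toℕ; fromℕ; fromℕ<; opposite)
open import Data.Fin.Permutation using (Permutation′; _⟨$⟩ʳ_; id; lift₀; _∘ₚ_; reverse)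
open import Data.Fin.Properties
  using (toℕ<n; toℕ-fromℕ; toℕ-fromℕ<; toℕ-injective; injective⇒≤; opposite-prop)
  renaming (suc-injective to Fin-suc-injective)
open import Data.List using (List; []; _∷_; length; lookup; filter; map; foldr; allFin; upTo; tabulate)
open import Data.List.Membership.Propositional using (_∈_; find)
open import Data.List.Membership.Propositional.Properties
  using (∈-lookup; ∈-allFin; ∈-filter⁺; ∈-filter⁻; ∈-map⁺; ∈-map⁻; ∈-concatMap⁺; ∈-concatMap⁻;
         ∈-upTo⁺; ∈-tabulate⁺; ∈-tabulate⁻)
open import Data.List.Properties using (foldr-preservesᵇ; foldr-forcesᵇ; length-map; length-upTo; length-tabulate)
open import Data.List.Relation.Binary.Subset.Propositional using (_⊆_)
open import Data.List.Relation.Unary.All as All using (All; []; _∷_)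
open import Data.List.Relation.Unary.All.Properties using (¬Any⇒All¬) renaming (map⁺ to All-map⁺)
open import Data.List.Relation.Unary.AllPairs using ([]; _∷_)
open import Data.List.Relation.Unary.Any as Any using (here; there; any?)
open import Data.List.Relation.Unary.Any.Properties using (lookup-index)
open import Data.List.Relation.Unary.Unique.Propositional using (Unique)
import Data.List.Relation.Unary.Unique.Propositional.Properties as Unique
open import Data.Nat using (ℕ; zero; suc; pred; _+_; _∸_; _⊔_; _⊓_; _≤_; _<_; _≤?_; _<?_; _≡ᵇ_;
                            z≤n; s≤s; s≤s⁻¹; >-nonZero)
open import Data.Nat.Properties
open import Data.Product using (∃; ∃₂; _×_; _,_; proj₁; proj₂; uncurry)
open import Data.Sum using (_⊎_; inj₁; inj₂)
open import Data.Unit using (tt)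
open import Function using (_∘_; Equivalence; Bijection)
open import Function.Properties.Inverse using (Inverse⇒Bijection)
open import Relation.Binary.PropositionalEquality
open import Relation.Nullary using (yes; no; contradiction)

private variable
  A : Set
  xs ys : List A

-- Duplicate-free lists

lookup-injective : Unique xs → ∀ i j → lookup xs i ≡ lookup xs j → i ≡ j
lookup-injective (_ ∷ _)     zero    zero    _  = refl
lookup-injective (x∉xs ∷ _)  zero    (suc j) eq = contradiction eq (All.lookup x∉xs (∈-lookup j))
lookup-injective (x∉xs ∷ _)  (suc i) zero    eq = contradiction (sym eq) (All.lookup x∉xs (∈-lookup i))
lookup-injective (_ ∷ xs!)   (suc i) (suc j) eq = cong suc (lookup-injective xs! i j eq)

unique-⊆⇒length≤ : Unique xs → xs ⊆ ys → length xs ≤ length ys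
unique-⊆⇒length≤ {xs = xs} {ys = ys} xs! xs⊆ys = injective⇒≤ index-injective
  where
  index : Fin (length xs) → Fin (length ys)
  index i = Any.index (xs⊆ys (∈-lookup i))
  index-injective : ∀ {i j} → index i ≡ index j → i ≡ j
  index-injective {i} {j} eq = lookup-injective xs! i j (begin
    lookup xs i         ≡⟨ lookup-index (xs⊆ys (∈-lookup i)) ⟩
    lookup ys (index i) ≡⟨ cong (lookup ys) eq ⟩
    lookup ys (index j) ≡⟨ lookup-index (xs⊆ys (∈-lookup j)) ⟨
    lookup xs j         ∎)
    where open ≡-Reasoning

unique-bounded⇒length≤ : ∀ {k} {xs : List ℕ} → Unique xs → All (_< k) xs → length xs ≤ k
unique-bounded⇒length≤ {k} {xs} xs! bounded = begin
  length xs       ≤⟨ unique-⊆⇒length≤ xs! (∈-upTo⁺ ∘ All.lookup bounded) ⟩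
  length (upTo k) ≡⟨ length-upTo k ⟩
  k               ∎
  where open ≤-Reasoning

∈⇒≤foldr-⊔ : ∀ {x} {xs : List ℕ} → x ∈ xs → x ≤ foldr _⊔_ 0 xs
∈⇒≤foldr-⊔ {xs = xs} = All.lookup (foldr-forcesᵇ (split (foldr _⊔_ 0 xs)) 0 xs ≤-refl)
  where
  split : ∀ o m n → m ⊔ n ≤ o → m ≤ o × n ≤ o
  split _ m n m⊔n≤o = m⊔n≤o⇒m≤o m n m⊔n≤o , m⊔n≤o⇒n≤o m n m⊔n≤o

foldr-⊔≤ : ∀ {k} {xs : List ℕ} → (∀ {x} → x ∈ xs → x ≤ k) → foldr _⊔_ 0 xs ≤ k
foldr-⊔≤ bounded = foldr-preservesᵇ ⊔-lub z≤n (All.tabulate bounded)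

-- The lower bound p + δ

neighbours : (G : Graph) → Fin (order G) → List (Fin (order G))
neighbours G v = filter (λ u → T? (adj G v u)) (allFin (order G))

module _ (G : Graph) where

  neighbours-unique : ∀ v → Unique (neighbours G v)
  neighbours-unique v = Unique.filter⁺ _ (Unique.allFin⁺ (order G))

  ∈-neighbours⁺ : ∀ {v u} → T (adj G v u) → u ∈ neighbours G v
  ∈-neighbours⁺ {u = u} = ∈-filter⁺ _ (∈-allFin u)

  ∈-neighbours⁻ : ∀ {v u} → u ∈ neighbours G v → T (adj G v u)
  ∈-neighbours⁻ {v} = proj₂ ∘ ∈-filter⁻ (λ u → T? (adj G v u)) {xs = allFin (order G)}

  deg≡length : ∀ {v} {us : List (Fin (order G))} → Unique us →
               (∀ {u} → u ∈ us → T (adj G v u)) → (∀ {u} → T (adj G v u) → u ∈ us) →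
               deg G v ≡ length us
  deg≡length {v} us! adjacent complete =
    ≤-antisym (unique-⊆⇒length≤ (neighbours-unique v) (complete ∘ ∈-neighbours⁻))
              (unique-⊆⇒length≤ us! (∈-neighbours⁺ ∘ adjacent))

δ≤deg : (G : Graph) (v : Fin (order G)) → δ G ≤ deg G v
δ≤deg G@record { order = suc m } v = foldr-⊓≤ (allFin (suc m)) (∈-allFin v)
  where
  foldr-⊓≤ : ∀ {e} xs → v ∈ xs → foldr (λ u acc → deg G u ⊓ acc) e xs ≤ deg G v
  foldr-⊓≤ (u ∷ _)  (here refl)  = m⊓n≤m (deg G u) _
  foldr-⊓≤ (u ∷ us) (there v∈us) = m≤n⇒o⊓m≤n (deg G u) (foldr-⊓≤ us v∈us)

≤δ : (G : Graph) → 0 < order G → ∀ {k} → (∀ v → k ≤ deg G v) → k ≤ δ G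
≤δ G@record { order = suc m } _ {k} k≤deg = ≤foldr-⊓ (allFin (suc m))
  where
  ≤foldr-⊓ : ∀ xs → k ≤ foldr (λ u acc → deg G u ⊓ acc) (deg G zero) xs
  ≤foldr-⊓ []       = k≤deg zero
  ≤foldr-⊓ (u ∷ us) = ⊓-glb (k≤deg u) (≤foldr-⊓ us)

module _ (G : Graph) (f : Numbering G) where

  private
    ℓ : Fin (order G) → ℕ
    ℓ = label {G} f

  edgeSumsAt : Fin (order G) → List ℕ
  edgeSumsAt u = map (λ v → ℓ u + ℓ v) (neighbours G u)

  edge≤strF : ∀ {u v} → T (adj G u v) → ℓ u + ℓ v ≤ strF G f
  edge≤strF {u} uv = ∈⇒≤foldr-⊔ (∈-concatMap⁺ edgeSumsAt
    (Any.map (λ { refl → ∈-map⁺ (λ w → ℓ u + ℓ w) (∈-neighbours⁺ G uv) }) (∈-allFin u)))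

  strF≤ : ∀ {k} → (∀ u v → T (adj G u v) → ℓ u + ℓ v ≤ k) → strF G f ≤ k
  strF≤ {k} bound = foldr-⊔≤ λ x∈sums →
    let u , _ , x∈sumsAt = find (∈-concatMap⁻ edgeSumsAt {xs = allFin (order G)} x∈sums)
        v , v∈N , x≡ = ∈-map⁻ (λ w → ℓ u + ℓ w) x∈sumsAt
    in subst (_≤ k) (sym x≡) (bound u v (∈-neighbours⁻ G v∈N))

  large-neighbour : ∀ v → 0 < deg G v → ∃ λ u → T (adj G v u) × deg G v ≤ ℓ u
  large-neighbour v deg>0 with any? (λ u → deg G v ≤? ℓ u) (neighbours G v)
  ... | yes some = let u , u∈N , large = find some in u , ∈-neighbours⁻ G u∈N , large
  ... | no none  = contradiction (m≤pred[n]⇒suc[m]≤n ⦃ >-nonZero deg>0 ⦄ deg≤pred[deg]) (<-irrefl refl)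
    where
    labels : List ℕ
    labels = map (toℕ ∘ proj₁ f) (neighbours G v)
    labels-unique : Unique labels
    labels-unique = Unique.map⁺ (proj₁ (proj₂ f) ∘ toℕ-injective) (neighbours-unique G v)
    labels-small : All (_< pred (deg G v)) labels
    labels-small = All-map⁺ (All.map (suc[m]≤n⇒m≤pred[n] ∘ ≰⇒>) (¬Any⇒All¬ _ none))
    deg≤pred[deg] : deg G v ≤ pred (deg G v)
    deg≤pred[deg] = subst (_≤ pred (deg G v)) (length-map _ (neighbours G v))
                          (unique-bounded⇒length≤ labels-unique labels-small)

label-surjective : (G : Graph) (f : Numbering G) (i : Fin (order G)) → ∃ λ v → label {G} f v ≡ suc (toℕ i)
label-surjective G f i with v , f[v]≡i ← proj₂ (proj₂ f) i = v , cong (suc ∘ toℕ) (f[v]≡i refl)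

order+δ≤strF : (G : Graph) (f : Numbering G) → 0 < δ G → order G + δ G ≤ strF G f
order+δ≤strF G@record { order = suc m } f δ>0
  with top , ℓtop≡1+toℕm ← label-surjective G f (fromℕ m)
  with u , top-u , deg≤ℓu ← large-neighbour G f top (<-≤-trans δ>0 (δ≤deg G top)) = begin
    suc m + δ G                          ≤⟨ +-monoʳ-≤ (suc m) (≤-trans (δ≤deg G top) deg≤ℓu) ⟩
    suc m + label {G} f u                ≡⟨ cong (λ k → suc k + label {G} f u) (toℕ-fromℕ m) ⟨
    suc (toℕ (fromℕ m)) + label {G} f u  ≡⟨ cong (_+ label {G} f u) ℓtop≡1+toℕm ⟨
    label {G} f top + label {G} f u      ≤⟨ edge≤strF G f top-u ⟩
    strF G f                             ∎
  where open ≤-Reasoning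

isStr-order+δ : (G : Graph) (f : Numbering G) → 0 < δ G → strF G f ≤ order G + δ G →
                IsStr G (order G + δ G)
isStr-order+δ G f δ>0 f-optimal =
  (f , ≤-antisym f-optimal (order+δ≤strF G f δ>0)) , λ g → order+δ≤strF G g δ>0

-- Degrees in wheels and fans

module _ (n : ℕ) (r : ℕ → ℕ → Bool) where

  baseNeighbours : Fin n → List (Fin n)
  baseNeighbours i = filter (λ j → T? (r (toℕ i) (toℕ j))) (allFin n)

  private
    baseNeighbours-unique : ∀ i → Unique (baseNeighbours i)
    baseNeighbours-unique i = Unique.filter⁺ _ (Unique.allFin⁺ n)

    ∈-baseNeighbours⁻ : ∀ {i j} → j ∈ baseNeighbours i → T (r (toℕ i) (toℕ j))
    ∈-baseNeighbours⁻ {i} = proj₂ ∘ ∈-filter⁻ (λ j → T? (r (toℕ i) (toℕ j))) {xs = allFin n}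

    ∈-baseNeighbours⁺ : ∀ {i j} → T (r (toℕ i) (toℕ j)) → j ∈ baseNeighbours i
    ∈-baseNeighbours⁺ {j = j} = ∈-filter⁺ _ (∈-allFin j)

  deg-cone-hub : deg (cone n r) zero ≡ n
  deg-cone-hub = trans (deg≡length (cone n r) {zero} rim-unique rim-adjacent rim-complete) (length-tabulate suc)
    where
    rim-unique : Unique (tabulate suc)
    rim-unique = Unique.tabulate⁺ Fin-suc-injective
    rim-adjacent : ∀ {u} → u ∈ tabulate suc → T (adj (cone n r) zero u)
    rim-adjacent u∈rim with _ , refl ← ∈-tabulate⁻ u∈rim = tt
    rim-complete : ∀ {u} → T (adj (cone n r) zero u) → u ∈ tabulate suc
    rim-complete {suc j} _ = ∈-tabulate⁺ j

  deg-cone-rim : ∀ i → deg (cone n r) (suc i) ≡ suc (length (baseNeighbours i))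
  deg-cone-rim i = trans (deg≡length (cone n r) {suc i} us-unique us-adjacent us-complete)
                         (cong suc (length-map suc (baseNeighbours i)))
    where
    us : List (Fin (suc n))
    us = zero ∷ map suc (baseNeighbours i)
    us-unique : Unique us
    us-unique = All-map⁺ (All.universal (λ _ ()) _) ∷ Unique.map⁺ Fin-suc-injective (baseNeighbours-unique i)
    us-adjacent : ∀ {u} → u ∈ us → T (adj (cone n r) (suc i) u)
    us-adjacent (here refl) = tt
    us-adjacent (there u∈us) with _ , j∈N , refl ← ∈-map⁻ suc u∈us = ∈-baseNeighbours⁻ j∈N
    us-complete : ∀ {u} → T (adj (cone n r) (suc i) u) → u ∈ us
    us-complete {zero}  _  = here refl
    us-complete {suc j} ij = there (∈-map⁺ suc (∈-baseNeighbours⁺ ij))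

  length-baseNeighbours-≥ : ∀ {i} {as : List ℕ} → Unique as →
    (∀ {a} → a ∈ as → a < n × T (r (toℕ i) a)) → length as ≤ length (baseNeighbours i)
  length-baseNeighbours-≥ {i} {as} as! adjacent = begin
    length as                           ≤⟨ unique-⊆⇒length≤ as! as⊆ ⟩
    length (map toℕ (baseNeighbours i)) ≡⟨ length-map toℕ (baseNeighbours i) ⟩
    length (baseNeighbours i)           ∎
    where
    open ≤-Reasoning
    as⊆ : as ⊆ map toℕ (baseNeighbours i)
    as⊆ a∈as with a<n , ia ← adjacent a∈as =
      subst (_∈ map toℕ (baseNeighbours i)) (toℕ-fromℕ< a<n)
        (∈-map⁺ toℕ (∈-baseNeighbours⁺ (subst (T ∘ r (toℕ i)) (sym (toℕ-fromℕ< a<n)) ia)))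

  length-baseNeighbours-≤ : ∀ {i} {as : List ℕ} →
    (∀ {j} → T (r (toℕ i) (toℕ j)) → toℕ j ∈ as) → length (baseNeighbours i) ≤ length as
  length-baseNeighbours-≤ {i} {as} complete = begin
    length (baseNeighbours i)           ≡⟨ length-map toℕ (baseNeighbours i) ⟨
    length (map toℕ (baseNeighbours i)) ≤⟨ unique-⊆⇒length≤ positions-unique ⊆as ⟩
    length as                           ∎
    where
    open ≤-Reasoning
    positions-unique : Unique (map toℕ (baseNeighbours i))
    positions-unique = Unique.map⁺ toℕ-injective (baseNeighbours-unique i)
    ⊆as : map toℕ (baseNeighbours i) ⊆ as
    ⊆as x∈ with _ , j∈N , refl ← ∈-map⁻ toℕ x∈ = complete (∈-baseNeighbours⁻ j∈N)

data PathAdjacent (a b : ℕ) : Set where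
  forward  : b ≡ suc a → PathAdjacent a b
  backward : a ≡ suc b → PathAdjacent a b

data CycleAdjacent (n a b : ℕ) : Set where
  along : PathAdjacent a b → CycleAdjacent n a b
  wrap  : a ≡ 0 → b ≡ n ∸ 1 → CycleAdjacent n a b
  wrap⁻ : b ≡ 0 → a ≡ n ∸ 1 → CycleAdjacent n a b

private
  T-∨⁻ : ∀ x {y} → T (x ∨ y) → T x ⊎ T y
  T-∨⁻ x = Equivalence.to (T-∨ {x})

  T-∨⁺ : ∀ x {y} → T x ⊎ T y → T (x ∨ y)
  T-∨⁺ x = Equivalence.from (T-∨ {x})

  T-∧⁻ : ∀ x {y} → T (x ∧ y) → T x × T y
  T-∧⁻ x = Equivalence.to (T-∧ {x})

  T-∧⁺ : ∀ x {y} → T x → T y → T (x ∧ y)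
  T-∧⁺ x p q = Equivalence.from (T-∧ {x}) (p , q)

pathAdj-sound : ∀ a b → T (pathAdj a b) → PathAdjacent a b
pathAdj-sound a b ab with T-∨⁻ (b ≡ᵇ suc a) ab
... | inj₁ b≡1+a = forward (≡ᵇ⇒≡ b (suc a) b≡1+a)
... | inj₂ a≡1+b = backward (≡ᵇ⇒≡ a (suc b) a≡1+b)

pathAdj-complete : ∀ {a b} → PathAdjacent a b → T (pathAdj a b)
pathAdj-complete {a} {b} (forward b≡1+a)  = T-∨⁺ (b ≡ᵇ suc a) (inj₁ (≡⇒≡ᵇ b (suc a) b≡1+a))
pathAdj-complete {a} {b} (backward a≡1+b) = T-∨⁺ (b ≡ᵇ suc a) (inj₂ (≡⇒≡ᵇ a (suc b) a≡1+b))

cycAdj-sound : ∀ n a b → T (cycAdj n a b) → CycleAdjacent n a b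
cycAdj-sound n a b ab with T-∨⁻ (b ≡ᵇ suc a) ab
... | inj₁ b≡1+a = along (forward (≡ᵇ⇒≡ b (suc a) b≡1+a))
... | inj₂ ab′ with T-∨⁻ (a ≡ᵇ suc b) ab′
... | inj₁ a≡1+b = along (backward (≡ᵇ⇒≡ a (suc b) a≡1+b))
... | inj₂ ab″ with T-∨⁻ ((a ≡ᵇ 0) ∧ (b ≡ᵇ n ∸ 1)) ab″
... | inj₁ w = let a≡0 , b≡n-1 = T-∧⁻ (a ≡ᵇ 0) w in wrap (≡ᵇ⇒≡ a 0 a≡0) (≡ᵇ⇒≡ b (n ∸ 1) b≡n-1)
... | inj₂ w = let b≡0 , a≡n-1 = T-∧⁻ (b ≡ᵇ 0) w in wrap⁻ (≡ᵇ⇒≡ b 0 b≡0) (≡ᵇ⇒≡ a (n ∸ 1) a≡n-1)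

cycAdj-complete : ∀ {n a b} → CycleAdjacent n a b → T (cycAdj n a b)
cycAdj-complete {n} {a} {b} (along (forward b≡1+a)) = T-∨⁺ (b ≡ᵇ suc a) (inj₁ (≡⇒≡ᵇ b (suc a) b≡1+a))
cycAdj-complete {n} {a} {b} (along (backward a≡1+b)) =
  T-∨⁺ (b ≡ᵇ suc a) (inj₂ (T-∨⁺ (a ≡ᵇ suc b) (inj₁ (≡⇒≡ᵇ a (suc b) a≡1+b))))
cycAdj-complete {n} {a} {b} (wrap a≡0 b≡n-1) =
  T-∨⁺ (b ≡ᵇ suc a) (inj₂ (T-∨⁺ (a ≡ᵇ suc b) (inj₂ (T-∨⁺ ((a ≡ᵇ 0) ∧ (b ≡ᵇ n ∸ 1))
    (inj₁ (T-∧⁺ (a ≡ᵇ 0) (≡⇒≡ᵇ a 0 a≡0) (≡⇒≡ᵇ b (n ∸ 1) b≡n-1)))))))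
cycAdj-complete {n} {a} {b} (wrap⁻ b≡0 a≡n-1) =
  T-∨⁺ (b ≡ᵇ suc a) (inj₂ (T-∨⁺ (a ≡ᵇ suc b) (inj₂ (T-∨⁺ ((a ≡ᵇ 0) ∧ (b ≡ᵇ n ∸ 1))
    (inj₂ (T-∧⁺ (b ≡ᵇ 0) (≡⇒≡ᵇ b 0 b≡0) (≡⇒≡ᵇ a (n ∸ 1) a≡n-1)))))))

pathAdjacent-suc : ∀ {a b} → PathAdjacent a b → PathAdjacent (suc a) (suc b)
pathAdjacent-suc (forward b≡1+a)  = forward (cong suc b≡1+a)
pathAdjacent-suc (backward a≡1+b) = backward (cong suc a≡1+b)

path-neighbour : ∀ {n i} → 2 ≤ n → i < n → ∃ λ a → a < n × PathAdjacent i a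
path-neighbour {n} {i} 2≤n i<n with suc i <? n
... | yes 1+i<n = suc i , 1+i<n , forward refl
path-neighbour {n} {zero}  2≤n i<n | no 1≮n = contradiction 2≤n 1≮n
path-neighbour {n} {suc i} 2≤n i<n | no _   = i , <-trans (n<1+n i) i<n , backward refl

cycle-neighbours : ∀ {n i} → 3 ≤ n → i < n →
  ∃₂ λ a b → a ≢ b × (a < n × CycleAdjacent n i a) × (b < n × CycleAdjacent n i b)
cycle-neighbours {n} {zero} 3≤n _ =
  1 , n ∸ 1 , <⇒≢ 1<n-1 , (2≤n , along (forward refl)) , (n-1<n , wrap refl refl)
  where
  2≤n : 2 ≤ n
  2≤n = ≤-trans (n≤1+n 2) 3≤n
  1<n-1 : 1 < n ∸ 1
  1<n-1 = ∸-monoˡ-≤ 1 3≤n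
  n-1<n : n ∸ 1 < n
  n-1<n = ∸-monoʳ-< {n} {1} {0} (s≤s z≤n) (≤-trans (s≤s z≤n) 3≤n)
cycle-neighbours {n} {suc i} 3≤n 1+i<n with suc (suc i) <? n
... | yes 2+i<n = i , suc (suc i) , <⇒≢ (<-trans (n<1+n i) (n<1+n (suc i))) ,
                  (<-trans (n<1+n i) 1+i<n , along (backward refl)) , (2+i<n , along (forward refl))
... | no 2+i≮n  = i , 0 , ≢-sym (<⇒≢ 0<i) , (<-trans (n<1+n i) 1+i<n , along (backward refl)) ,
                  (≤-trans (s≤s z≤n) 1+i<n , wrap⁻ refl (cong (_∸ 1) 2+i≡n))
  where
  2+i≡n : suc (suc i) ≡ n
  2+i≡n = ≤-antisym 1+i<n (≮⇒≥ 2+i≮n)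
  0<i : 0 < i
  0<i = s≤s⁻¹ (s≤s⁻¹ (subst (3 ≤_) (sym 2+i≡n) 3≤n))

δ-wheel : ∀ {n} → 3 ≤ n → δ (wheel n) ≡ 3
δ-wheel {n@(suc _)} 3≤n = ≤-antisym (≤-trans (δ≤deg (wheel n) (suc zero)) deg₁≤3) (≤δ (wheel n) (s≤s z≤n) 3≤deg)
  where
  3≤deg : ∀ v → 3 ≤ deg (wheel n) v
  3≤deg zero = subst (3 ≤_) (sym (deg-cone-hub n (cycAdj n))) 3≤n
  3≤deg (suc i) with a , b , a≢b , (a<n , ia) , (b<n , ib) ← cycle-neighbours 3≤n (toℕ<n i) =
    subst (3 ≤_) (sym (deg-cone-rim n (cycAdj n) i))
      (s≤s (length-baseNeighbours-≥ n (cycAdj n) ((a≢b ∷ []) ∷ [] ∷ []) λ where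
        (here refl)         → a<n , cycAdj-complete ia
        (there (here refl)) → b<n , cycAdj-complete ib))
  neighbours₀ : ∀ {j} → T (cycAdj n 0 (toℕ j)) → toℕ j ∈ 1 ∷ n ∸ 1 ∷ []
  neighbours₀ {j} 0j with cycAdj-sound n 0 (toℕ j) 0j
  ... | along (forward j≡1) = here j≡1
  ... | wrap _ j≡n-1        = there (here j≡n-1)
  ... | wrap⁻ _ refl        = contradiction 3≤n λ { (s≤s ()) }
  deg₁≤3 : deg (wheel n) (suc zero) ≤ 3
  deg₁≤3 = subst (_≤ 3) (sym (deg-cone-rim n (cycAdj n) zero))
             (s≤s (length-baseNeighbours-≤ n (cycAdj n) neighbours₀))

δ-fan : ∀ {n} → 2 ≤ n → δ (fan n) ≡ 2
δ-fan {n@(suc _)} 2≤n = ≤-antisym (≤-trans (δ≤deg (fan n) (suc zero)) deg₁≤2) (≤δ (fan n) (s≤s z≤n) 2≤deg)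
  where
  2≤deg : ∀ v → 2 ≤ deg (fan n) v
  2≤deg zero = subst (2 ≤_) (sym (deg-cone-hub n pathAdj)) 2≤n
  2≤deg (suc i) with a , a<n , ia ← path-neighbour 2≤n (toℕ<n i) =
    subst (2 ≤_) (sym (deg-cone-rim n pathAdj i))
      (s≤s (length-baseNeighbours-≥ n pathAdj ([] ∷ []) λ where
        (here refl) → a<n , pathAdj-complete ia))
  neighbours₀ : ∀ {j} → T (pathAdj 0 (toℕ j)) → toℕ j ∈ 1 ∷ []
  neighbours₀ {j} 0j with pathAdj-sound 0 (toℕ j) 0j
  ... | forward j≡1 = here j≡1
  deg₁≤2 : deg (fan n) (suc zero) ≤ 2
  deg₁≤2 = subst (_≤ 2) (sym (deg-cone-rim n pathAdj zero))
             (s≤s (length-baseNeighbours-≤ n pathAdj neighbours₀))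

-- The zigzag numbering

-- Along positions 0, 1, 2, 3, … the values toℕ (zigzag n ⟨$⟩ʳ i) are 0, n−1, 1, n−2, ….
zigzag : ∀ n → Permutation′ n
zigzag zero    = id
zigzag (suc n) = lift₀ (zigzag n ∘ₚ reverse)

private
  value : ∀ n → Fin n → ℕ
  value n i = toℕ (zigzag n ⟨$⟩ʳ i)

toℕ-suc-opposite : ∀ {m} (x : Fin m) → toℕ (suc (opposite x)) + toℕ x ≡ m
toℕ-suc-opposite {m} x = begin
  suc (toℕ (opposite x)) + toℕ x ≡⟨ +-suc (toℕ (opposite x)) (toℕ x) ⟨
  toℕ (opposite x) + suc (toℕ x) ≡⟨ cong (_+ suc (toℕ x)) (opposite-prop x) ⟩
  m ∸ suc (toℕ x) + suc (toℕ x)  ≡⟨ m∸n+n≡m (toℕ<n x) ⟩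
  m                              ∎
  where open ≡-Reasoning

complement-sum-bounds : ∀ {m a b a′ b′} → a′ + a ≡ m → b′ + b ≡ m →
  m ≤ suc (a + b) → a + b ≤ m → suc m ≤ suc (a′ + b′) × a′ + b′ ≤ suc m
complement-sum-bounds {m} {a} {b} {a′} {b′} a′+a≡m b′+b≡m m≤1+s s≤m =
  s≤s (+-cancelʳ-≤ (a + b) m (a′ + b′) (begin
    m + (a + b)               ≤⟨ +-monoʳ-≤ m s≤m ⟩
    m + m                     ≡⟨ total ⟨
    (a′ + b′) + (a + b)       ∎)) ,
  +-cancelʳ-≤ m (a′ + b′) (suc m) (begin
    (a′ + b′) + m             ≤⟨ +-monoʳ-≤ (a′ + b′) m≤1+s ⟩
    (a′ + b′) + suc (a + b)   ≡⟨ +-suc (a′ + b′) (a + b) ⟩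
    suc ((a′ + b′) + (a + b)) ≡⟨ cong suc total ⟩
    suc m + m                 ∎)
  where
  open ≤-Reasoning
  total : (a′ + b′) + (a + b) ≡ m + m
  total = trans (interchange +-commutativeSemigroup a′ b′ a b) (cong₂ _+_ a′+a≡m b′+b≡m)

zigzag-consecutive : ∀ {n} (i j : Fin n) → toℕ j ≡ suc (toℕ i) →
  n ≤ suc (value n i + value n j) × value n i + value n j ≤ n
zigzag-consecutive {suc (suc m)} zero (suc zero) refl =
  ≤-reflexive (cong (2 +_) (sym (toℕ-fromℕ m))) , ≤-trans (≤-reflexive (cong suc (toℕ-fromℕ m))) (n≤1+n _)
zigzag-consecutive {suc m} (suc i) (suc j) 1+i≡j =
  uncurry (complement-sum-bounds {a = value m i} {b = value m j}
             (toℕ-suc-opposite (zigzag m ⟨$⟩ʳ i)) (toℕ-suc-opposite (zigzag m ⟨$⟩ʳ j)))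
    (zigzag-consecutive i j (suc-injective 1+i≡j))

zigzag-pathAdjacent : ∀ {n} {i j : Fin n} → PathAdjacent (toℕ i) (toℕ j) → value n i + value n j ≤ n
zigzag-pathAdjacent {n} {i} {j} (forward j≡1+i)  = proj₂ (zigzag-consecutive i j j≡1+i)
zigzag-pathAdjacent {n} {i} {j} (backward i≡1+j) =
  subst (_≤ n) (+-comm (value n j) (value n i)) (proj₂ (zigzag-consecutive j i i≡1+j))

zigzag-cycleAdjacent : ∀ {n} {i j : Fin n} → CycleAdjacent n (toℕ i) (toℕ j) → value n i + value n j ≤ n
zigzag-cycleAdjacent (along ij) = zigzag-pathAdjacent ij
zigzag-cycleAdjacent {i = zero} {j} (wrap _ _) = <⇒≤ (toℕ<n (zigzag _ ⟨$⟩ʳ j))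
zigzag-cycleAdjacent {i = suc _} (wrap () _)
zigzag-cycleAdjacent {n} {i} {zero} (wrap⁻ _ _) =
  subst (_≤ n) (sym (+-identityʳ (value n i))) (<⇒≤ (toℕ<n (zigzag n ⟨$⟩ʳ i)))
zigzag-cycleAdjacent {j = suc _} (wrap⁻ () _)

numbering : (G : Graph) → Permutation′ (order G) → Numbering G
numbering G π = (π ⟨$⟩ʳ_) , Bijection.bijective (Inverse⇒Bijection π)

hubFirst : ∀ {n} r → Permutation′ n → Numbering (cone n r)
hubFirst {n} r ρ = numbering (cone n r) (lift₀ ρ)

-- The rim vertex i is labelled 2 + toℕ (ρ ⟨$⟩ʳ i).
cone-strF≤ : ∀ {n} r (ρ : Permutation′ n) {k} → 2 + n ≤ k →
  (∀ i j → T (r (toℕ i) (toℕ j)) → 4 + (toℕ (ρ ⟨$⟩ʳ i) + toℕ (ρ ⟨$⟩ʳ j)) ≤ k) →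
  strF (cone n r) (hubFirst r ρ) ≤ k
cone-strF≤ {n} r ρ {k} 2+n≤k rim≤k = strF≤ (cone n r) (hubFirst r ρ) edge≤k
  where
  ℓ : Fin (suc n) → ℕ
  ℓ = label {cone n r} (hubFirst r ρ)
  1+ℓ≤k : ∀ v → 1 + ℓ v ≤ k
  1+ℓ≤k v = ≤-trans (s≤s (toℕ<n (lift₀ ρ ⟨$⟩ʳ v))) 2+n≤k
  edge≤k : ∀ u v → T (adj (cone n r) u v) → ℓ u + ℓ v ≤ k
  edge≤k zero    v       _  = 1+ℓ≤k v
  edge≤k (suc i) zero    _  = subst (_≤ k) (+-comm 1 (ℓ (suc i))) (1+ℓ≤k (suc i))
  edge≤k (suc i) (suc j) ij = subst (_≤ k) (cong (2 +_) (sym (2+-suc-suc _ _))) (rim≤k i j ij)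
    where
    2+-suc-suc : ∀ a b → a + suc (suc b) ≡ suc (suc (a + b))
    2+-suc-suc a b = trans (+-suc a (suc b)) (cong suc (+-suc a b))

wheel-strF≤ : ∀ n → strF (wheel n) (hubFirst (cycAdj n) (zigzag n)) ≤ suc n + 3
wheel-strF≤ n = subst (strF (wheel n) (hubFirst (cycAdj n) (zigzag n)) ≤_) (cong suc (+-comm 3 n))
  (cone-strF≤ (cycAdj n) (zigzag n) (+-monoˡ-≤ n (s≤s (s≤s z≤n))) λ i j ij →
    +-monoʳ-≤ 4 (zigzag-cycleAdjacent (cycAdj-sound n (toℕ i) (toℕ j) ij)))

-- hubFirst pathAdj (zigzag n ∘ₚ reverse) is zigzag (suc n): the zigzag of the path with the hub prepended.
fan-strF≤ : ∀ n → strF (fan n) (hubFirst pathAdj (zigzag n ∘ₚ reverse)) ≤ suc n + 2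
fan-strF≤ n = subst (strF (fan n) (hubFirst pathAdj (zigzag n ∘ₚ reverse)) ≤_) (cong suc (+-comm 2 n))
  (cone-strF≤ pathAdj (zigzag n ∘ₚ reverse) (n≤1+n (2 + n)) λ i j ij →
    subst (_≤ 3 + n) (cong (3 +_) (+-suc (toℕ (zigzag n ∘ₚ reverse ⟨$⟩ʳ i)) _))
      (+-monoʳ-≤ 2 (zigzag-pathAdjacent (pathAdjacent-suc (pathAdj-sound (toℕ i) (toℕ j) ij)))))

mainTheorem14 : ((n : ℕ) → 3 ≤ n → IsStr (wheel n) (order (wheel n) + δ (wheel n)))
              × ((n : ℕ) → 2 ≤ n → IsStr (fan n) (order (fan n) + δ (fan n)))
mainTheorem14 = wheel-str , fan-str
  where
  wheel-str : (n : ℕ) → 3 ≤ n → IsStr (wheel n) (order (wheel n) + δ (wheel n))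
  wheel-str n 3≤n = isStr-order+δ (wheel n) (hubFirst (cycAdj n) (zigzag n))
    (subst (0 <_) (sym δ≡3) (s≤s z≤n))
    (subst (λ d → strF (wheel n) (hubFirst (cycAdj n) (zigzag n)) ≤ suc n + d) (sym δ≡3) (wheel-strF≤ n))
    where
    δ≡3 : δ (wheel n) ≡ 3
    δ≡3 = δ-wheel 3≤n
  fan-str : (n : ℕ) → 2 ≤ n → IsStr (fan n) (order (fan n) + δ (fan n))
  fan-str n 2≤n = isStr-order+δ (fan n) (hubFirst pathAdj (zigzag n ∘ₚ reverse))
    (subst (0 <_) (sym δ≡2) (s≤s z≤n))
    (subst (λ d → strF (fan n) (hubFirst pathAdj (zigzag n ∘ₚ reverse)) ≤ suc n + d) (sym δ≡2) (fan-strF≤ n))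
    where
    δ≡2 : δ (fan n) ≡ 2
    δ≡2 = δ-fan 2≤n
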